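{- For all integers $m,n\ge1$, the number of positions of \textsc{Cis} played on the complete bipartite graph $K_{m,n}$ is \[P_{\textsc{Cis},K_{m,n}}(1,1)=3^m+3^n-1.\]
   Context: A distance game given by a pair of sets $(S,D)$ of positive integers is played on a finite graph by two players, Left (colouring vertices blue) and Right (colouring vertices red). A position is any assignment to a subset of the vertices of the colours blue or red (other vertices empty) such that no two vertices of the same colour are at graph distance in $S$ and no two vertices of different colours are at graph distance in $D$; no assumption of alternating play is made. \textsc{Cis} is the distance game with $S=D=\{1\}$ (no two coloured vertices adjacent). $P_{G,B}(1,1)$ is the total number of positions of $G$ on $B$. -}

module Defs where

open import Data.Nat using (ℕ; zero; suc; _+_)
open import Data.Bool using (Bool; true; false; _∧_; not; _∨_)
open import Data.Fin using (Fin; splitAt)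
open import Data.Sum using (inj₁; inj₂)
open import Data.Vec using (Vec; []; _∷_; lookup)
open import Data.List using (List; []; _∷_; map; concatMap; length; filter; allFin)
open import Data.Product using (_×_; _,_)
open import Relation.Nullary using (Dec; yes; no)
open import Relation.Nullary.Decidable using (T?)
open import Data.Bool using (T)

-- A finite simple graph on vertex set Fin v, given by a Boolean adjacency
-- function (assumed symmetric and irreflexive by the concrete instances).
record Graph (v : ℕ) : Set where
  field
    adj : Fin v → Fin v → Bool
open Graph public

-- The state of a vertex: empty, blue (Left) or red (Right).
data Cell : Set where
  empty blue red : Cell

coloured : Cell → Bool
coloured empty = false
coloured blue  = true
coloured red   = true

assignments : (v : ℕ) → List (Vec Cell v)
assignments zero    = [] ∷ []
assignments (suc v) =
  concatMap (λ c → map (c ∷_) (assignments v)) (empty ∷ blue ∷ red ∷ [])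

-- CIS legality: S = D = {1}, i.e. no two coloured vertices (of any colours)
-- at distance 1, i.e. adjacent.
allB : {A : Set} → (A → Bool) → List A → Bool
allB p []       = true
allB p (x ∷ xs) = p x ∧ allB p xs

isCisPosition : {v : ℕ} → Graph v → Vec Cell v → Bool
isCisPosition {v} G a =
  allB (λ i → allB (λ j →
    not (adj G i j ∧ coloured (lookup a i) ∧ coloured (lookup a j)))
    (allFin v)) (allFin v)

numCisPositions : {v : ℕ} → Graph v → ℕ
numCisPositions {v} G = length (filter (λ a → T? (isCisPosition G a)) (assignments v))

-- Complete bipartite graph K_{m,n} on Fin (m + n): the first m vertices form
-- one part, the last n the other; edges exactly between the parts.
side : (m n : ℕ) → Fin (m + n) → Bool
side m n i with splitAt m i
... | inj₁ _ = true
... | inj₂ _ = false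

K : (m n : ℕ) → Graph (m + n)
K m n = record { adj = λ i j → not (side m n i ∧ side m n j) ∧ (side m n i ∨ side m n j) }

{-# OPTIONS --safe #-}
module Submission where

open import Defs
open import Data.Bool using (Bool; true; false; _∧_; _∨_; not; if_then_else_; T?)
open import Data.Bool.Properties using (∧-comm; ∧-zeroʳ)
open import Data.Fin using (Fin; _↑ˡ_; _↑ʳ_; splitAt)
open import Data.Fin.Properties using (splitAt-↑ˡ; splitAt-↑ʳ; splitAt⁻¹-↑ˡ; splitAt⁻¹-↑ʳ)
open import Data.List using (List; []; _∷_; map; length; filter; allFin)
  renaming (_++_ to _++ₗ_)
open import Data.List.Membership.Propositional using (_∈_)
open import Data.List.Membership.Propositional.Properties using (∈-allFin)
open import Data.List.Properties using (map-++; map-∘; ++-identityʳ)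
open import Data.List.Relation.Unary.Any using (here; there)
open import Data.Nat using (ℕ; zero; suc; _+_; _*_; _∸_; _^_; _≥_)
open import Data.Nat.ListAction using (sum)
open import Data.Nat.ListAction.Properties using (sum-++)
open import Data.Nat.Properties using (+-comm; +-identityʳ; *-identityˡ; *-identityʳ; m+n∸n≡m)
open import Data.Nat.Tactic.RingSolver using (solve-∀)
open import Data.Product using (∃; _,_)
open import Data.Sum using (inj₁; inj₂)
open import Data.Vec using (Vec; []; _∷_; lookup; _++_)
open import Data.Vec.Properties using (lookup-++ˡ; lookup-++ʳ)
open import Function using (_∘_)
open import Relation.Nullary.Negation using (contradiction)
open import Relation.Binary.PropositionalEquality
  using (_≡_; refl; sym; trans; cong; cong₂; subst; module ≡-Reasoning)

-- On K_{m,n} every vertex of one part is adjacent to every vertex of the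
-- other and to nothing else, so an assignment xs ++ ys is a position iff one
-- of xs, ys is entirely empty.  Counting those with xs not entirely empty and
-- ys empty, plus those with xs empty, gives (3^m − 1) + 3^n.

boolToℕ : Bool → ℕ
boolToℕ true  = 1
boolToℕ false = 0

length-filter-T? : {A : Set} (p : A → Bool) (xs : List A) →
  length (filter (λ x → T? (p x)) xs) ≡ sum (map (boolToℕ ∘ p) xs)
length-filter-T? p [] = refl
length-filter-T? p (x ∷ xs) with p x
... | true  = cong suc (length-filter-T? p xs)
... | false = length-filter-T? p xs

sumAssignments : (v : ℕ) → (Vec Cell v → ℕ) → ℕ
sumAssignments zero    w = w []
sumAssignments (suc v) w =
  sumAssignments v (w ∘ (empty ∷_)) + (sumAssignments v (w ∘ (blue ∷_)) + sumAssignments v (w ∘ (red ∷_)))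

sumAssignments-cong : ∀ v {w w′ : Vec Cell v → ℕ} → (∀ a → w a ≡ w′ a) →
  sumAssignments v w ≡ sumAssignments v w′
sumAssignments-cong zero    w≗w′ = w≗w′ []
sumAssignments-cong (suc v) w≗w′ =
  cong₂ _+_ (sumAssignments-cong v (w≗w′ ∘ (empty ∷_)))
    (cong₂ _+_ (sumAssignments-cong v (w≗w′ ∘ (blue ∷_))) (sumAssignments-cong v (w≗w′ ∘ (red ∷_))))

sum-map-assignments : ∀ v (w : Vec Cell v → ℕ) →
  sum (map w (assignments v)) ≡ sumAssignments v w
sum-map-assignments zero    w = +-identityʳ (w [])
sum-map-assignments (suc v) w = begin
  sum (map w (map (empty ∷_) A ++ₗ (map (blue ∷_) A ++ₗ (map (red ∷_) A ++ₗ []))))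
    ≡⟨ cong (sum ∘ map w ∘ (λ zs → map (empty ∷_) A ++ₗ (map (blue ∷_) A ++ₗ zs))) (++-identityʳ _) ⟩
  sum (map w (map (empty ∷_) A ++ₗ (map (blue ∷_) A ++ₗ map (red ∷_) A)))
    ≡⟨ sum-map-++ (map (empty ∷_) A) _ ⟩
  sum (map w (map (empty ∷_) A)) + sum (map w (map (blue ∷_) A ++ₗ map (red ∷_) A))
    ≡⟨ cong (sum (map w (map (empty ∷_) A)) +_) (sum-map-++ (map (blue ∷_) A) _) ⟩
  sum (map w (map (empty ∷_) A)) + (sum (map w (map (blue ∷_) A)) + sum (map w (map (red ∷_) A)))
    ≡⟨ cong₂ _+_ (part empty) (cong₂ _+_ (part blue) (part red)) ⟩
  sumAssignments (suc v) w ∎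
  where
  open ≡-Reasoning
  A : List (Vec Cell v)
  A = assignments v
  sum-map-++ : ∀ xs ys → sum (map w (xs ++ₗ ys)) ≡ sum (map w xs) + sum (map w ys)
  sum-map-++ xs ys = trans (cong sum (map-++ w xs ys)) (sum-++ (map w xs) (map w ys))
  part : ∀ c → sum (map w (map (c ∷_) A)) ≡ sumAssignments v (w ∘ (c ∷_))
  part c = trans (cong sum (sym (map-∘ A))) (sum-map-assignments v (w ∘ (c ∷_)))

sumAssignments-++ : ∀ m n (w : Vec Cell (m + n) → ℕ) →
  sumAssignments (m + n) w ≡ sumAssignments m (λ xs → sumAssignments n (λ ys → w (xs ++ ys)))
sumAssignments-++ zero    n w = refl
sumAssignments-++ (suc m) n w =
  cong₂ _+_ (sumAssignments-++ m n _) (cong₂ _+_ (sumAssignments-++ m n _) (sumAssignments-++ m n _))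

sumAssignments-const : ∀ v a → sumAssignments v (λ _ → a) ≡ a * 3 ^ v
sumAssignments-const zero    a = sym (*-identityʳ a)
sumAssignments-const (suc v) a rewrite sumAssignments-const v a = triple a (3 ^ v)
  where
  triple : ∀ x t → x * t + (x * t + x * t) ≡ x * (3 * t)
  triple = solve-∀

anyColoured : ∀ {v} → Vec Cell v → Bool
anyColoured []       = false
anyColoured (c ∷ cs) = coloured c ∨ anyColoured cs

coloured-lookup⇒anyColoured : ∀ {v} (cs : Vec Cell v) i →
  coloured (lookup cs i) ≡ true → anyColoured cs ≡ true
coloured-lookup⇒anyColoured (blue ∷ cs) Fin.zero _ = refl
coloured-lookup⇒anyColoured (red  ∷ cs) Fin.zero _ = refl
coloured-lookup⇒anyColoured (empty ∷ cs) (Fin.suc i) h = coloured-lookup⇒anyColoured cs i h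
coloured-lookup⇒anyColoured (blue ∷ cs) (Fin.suc i) h = refl
coloured-lookup⇒anyColoured (red  ∷ cs) (Fin.suc i) h = refl

anyColoured⇒coloured-lookup : ∀ {v} (cs : Vec Cell v) →
  anyColoured cs ≡ true → ∃ λ i → coloured (lookup cs i) ≡ true
anyColoured⇒coloured-lookup (blue ∷ cs) _ = Fin.zero , refl
anyColoured⇒coloured-lookup (red  ∷ cs) _ = Fin.zero , refl
anyColoured⇒coloured-lookup (empty ∷ cs) h with anyColoured⇒coloured-lookup cs h
... | i , coloured-i = Fin.suc i , coloured-i

-- The extra a on the left avoids truncated subtraction; with a = 0, b = 1 it
-- says that exactly one assignment is entirely empty.
sumAssignments-if-anyColoured : ∀ v a b →
  sumAssignments v (λ cs → if anyColoured cs then a else b) + a ≡ a * 3 ^ v + b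
sumAssignments-if-anyColoured zero    a b = trans (+-comm b a) (cong (_+ b) (sym (*-identityʳ a)))
sumAssignments-if-anyColoured (suc v) a b = begin
  (X + (S a + S a)) + a
    ≡⟨ swap X (S a) a ⟩
  (X + a) + (S a + S a)
    ≡⟨ cong₂ (λ l r → l + (r + r)) (sumAssignments-if-anyColoured v a b) (sumAssignments-const v a) ⟩
  (a * 3 ^ v + b) + (a * 3 ^ v + a * 3 ^ v)
    ≡⟨ collect a (3 ^ v) b ⟩
  a * 3 ^ suc v + b ∎
  where
  open ≡-Reasoning
  X : ℕ
  X = sumAssignments v (λ cs → if anyColoured cs then a else b)
  S : ℕ → ℕ
  S c = sumAssignments v (λ _ → c)
  swap : ∀ x y z → (x + (y + y)) + z ≡ (x + z) + (y + y)
  swap = solve-∀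
  collect : ∀ x t y → (x * t + y) + (x * t + x * t) ≡ x * (3 * t) + y
  collect = solve-∀

allB-true : {A : Set} {p : A → Bool} → (∀ x → p x ≡ true) → (xs : List A) → allB p xs ≡ true
allB-true p≡true []       = refl
allB-true p≡true (x ∷ xs) rewrite p≡true x = allB-true p≡true xs

allB-false : {A : Set} {p : A → Bool} {x : A} {xs : List A} → x ∈ xs → p x ≡ false → allB p xs ≡ false
allB-false (here refl) px≡false rewrite px≡false = refl
allB-false {p = p} {xs = y ∷ _} (there x∈xs) px≡false =
  trans (cong (p y ∧_) (allB-false x∈xs px≡false)) (∧-zeroʳ (p y))

isCisPosition-true : ∀ {v} (G : Graph v) (a : Vec Cell v) →
  (∀ i j → (adj G i j ∧ coloured (lookup a i) ∧ coloured (lookup a j)) ≡ false) →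
  isCisPosition G a ≡ true
isCisPosition-true {v} G a noConflict =
  allB-true (λ i → allB-true (λ j → cong not (noConflict i j)) (allFin v)) (allFin v)

isCisPosition-false : ∀ {v} (G : Graph v) (a : Vec Cell v) i j → adj G i j ≡ true →
  coloured (lookup a i) ≡ true → coloured (lookup a j) ≡ true → isCisPosition G a ≡ false
isCisPosition-false G a i j ij∈G coloured-i coloured-j =
  allB-false (∈-allFin i) (allB-false (∈-allFin j) conflict)
  where
  conflict : not (adj G i j ∧ coloured (lookup a i) ∧ coloured (lookup a j)) ≡ false
  conflict rewrite ij∈G | coloured-i | coloured-j = refl

splitAt-elim : ∀ m n {P : Fin (m + n) → Set} →
  (∀ k → P (k ↑ˡ n)) → (∀ k → P (m ↑ʳ k)) → ∀ i → P i
splitAt-elim m n {P} Pˡ Pʳ i with splitAt m i in eq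
... | inj₁ k = subst P (splitAt⁻¹-↑ˡ eq) (Pˡ k)
... | inj₂ k = subst P (splitAt⁻¹-↑ʳ eq) (Pʳ k)

side-↑ˡ : ∀ m n (k : Fin m) → side m n (k ↑ˡ n) ≡ true
side-↑ˡ m n k rewrite splitAt-↑ˡ m k n = refl

side-↑ʳ : ∀ m n (k : Fin n) → side m n (m ↑ʳ k) ≡ false
side-↑ʳ m n k rewrite splitAt-↑ʳ m n k = refl

K-adj-↑ˡ-↑ʳ : ∀ m n (k : Fin m) (k′ : Fin n) → adj (K m n) (k ↑ˡ n) (m ↑ʳ k′) ≡ true
K-adj-↑ˡ-↑ʳ m n k k′ rewrite side-↑ˡ m n k | side-↑ʳ m n k′ = refl

module _ {m n : ℕ} (xs : Vec Cell m) (ys : Vec Cell n) where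

  colouredPair-false : (anyColoured xs ∧ anyColoured ys) ≡ false → ∀ k k′ →
    (coloured (lookup xs k) ∧ coloured (lookup ys k′)) ≡ false
  colouredPair-false noneOnOneSide k k′
    with coloured (lookup xs k) in coloured-k | coloured (lookup ys k′) in coloured-k′
  ... | false | _     = refl
  ... | true  | false = refl
  ... | true  | true  = contradiction
    (trans (sym (cong₂ _∧_ (coloured-lookup⇒anyColoured xs k coloured-k)
                           (coloured-lookup⇒anyColoured ys k′ coloured-k′)))
           noneOnOneSide)
    λ ()

  conflictAt : Fin (m + n) → Fin (m + n) → Bool
  conflictAt i j = adj (K m n) i j ∧ coloured (lookup (xs ++ ys) i) ∧ coloured (lookup (xs ++ ys) j)

  K-noConflict : (anyColoured xs ∧ anyColoured ys) ≡ false → ∀ i j → conflictAt i j ≡ false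
  K-noConflict noneOnOneSide =
    splitAt-elim m n (λ k → splitAt-elim m n (left-left k) (left-right k))
                     (λ k → splitAt-elim m n (right-left k) (right-right k))
    where
    left-left : ∀ k k′ → conflictAt (k ↑ˡ n) (k′ ↑ˡ n) ≡ false
    left-left k k′ rewrite side-↑ˡ m n k | side-↑ˡ m n k′ = refl
    right-right : ∀ k k′ → conflictAt (m ↑ʳ k) (m ↑ʳ k′) ≡ false
    right-right k k′ rewrite side-↑ʳ m n k | side-↑ʳ m n k′ = refl
    left-right : ∀ k k′ → conflictAt (k ↑ˡ n) (m ↑ʳ k′) ≡ false
    left-right k k′ rewrite K-adj-↑ˡ-↑ʳ m n k k′ | lookup-++ˡ xs ys k | lookup-++ʳ xs ys k′ =
      colouredPair-false noneOnOneSide k k′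
    right-left : ∀ k k′ → conflictAt (m ↑ʳ k) (k′ ↑ˡ n) ≡ false
    right-left k k′ rewrite side-↑ʳ m n k | side-↑ˡ m n k′ | lookup-++ʳ xs ys k | lookup-++ˡ xs ys k′ =
      trans (∧-comm (coloured (lookup ys k)) _) (colouredPair-false noneOnOneSide k′ k)

  isCisPosition-K : isCisPosition (K m n) (xs ++ ys) ≡ not (anyColoured xs ∧ anyColoured ys)
  isCisPosition-K with anyColoured xs in anyˣ | anyColoured ys in anyʸ
  ... | true  | true
    with k , coloured-k ← anyColoured⇒coloured-lookup xs anyˣ
       | k′ , coloured-k′ ← anyColoured⇒coloured-lookup ys anyʸ =
    isCisPosition-false (K m n) (xs ++ ys) (k ↑ˡ n) (m ↑ʳ k′) (K-adj-↑ˡ-↑ʳ m n k k′)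
      (trans (cong coloured (lookup-++ˡ xs ys k)) coloured-k)
      (trans (cong coloured (lookup-++ʳ xs ys k′)) coloured-k′)
  ... | true  | false = isCisPosition-true (K m n) (xs ++ ys) (K-noConflict (cong₂ _∧_ anyˣ anyʸ))
  ... | false | _     = isCisPosition-true (K m n) (xs ++ ys) (K-noConflict (cong₂ _∧_ anyˣ anyʸ))

boolToℕ-not : ∀ b → boolToℕ (not b) ≡ (if b then 0 else 1)
boolToℕ-not true  = refl
boolToℕ-not false = refl

sumAssignments-positions-K : ∀ m n (xs : Vec Cell m) →
  sumAssignments n (λ ys → boolToℕ (isCisPosition (K m n) (xs ++ ys))) ≡ (if anyColoured xs then 1 else 3 ^ n)
sumAssignments-positions-K m n xs =
  trans (sumAssignments-cong n (λ ys → cong boolToℕ (isCisPosition-K xs ys))) (extensions (anyColoured xs))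
  where
  extensions : ∀ b → sumAssignments n (λ ys → boolToℕ (not (b ∧ anyColoured ys))) ≡ (if b then 1 else 3 ^ n)
  extensions true  = begin
    sumAssignments n (λ ys → boolToℕ (not (anyColoured ys)))
      ≡⟨ sumAssignments-cong n (boolToℕ-not ∘ anyColoured) ⟩
    sumAssignments n (λ ys → if anyColoured ys then 0 else 1)
      ≡⟨ sym (+-identityʳ _) ⟩
    sumAssignments n (λ ys → if anyColoured ys then 0 else 1) + 0
      ≡⟨ sumAssignments-if-anyColoured n 0 1 ⟩
    1 ∎
    where open ≡-Reasoning
  extensions false = trans (sumAssignments-const n 1) (*-identityˡ (3 ^ n))

numCisPositions-K : ∀ m n →
  numCisPositions (K m n) ≡ sumAssignments m (λ xs → if anyColoured xs then 1 else 3 ^ n)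
numCisPositions-K m n = begin
  length (filter (λ a → T? (isCisPosition (K m n) a)) (assignments (m + n)))
    ≡⟨ length-filter-T? (isCisPosition (K m n)) (assignments (m + n)) ⟩
  sum (map (boolToℕ ∘ isCisPosition (K m n)) (assignments (m + n)))
    ≡⟨ sum-map-assignments (m + n) _ ⟩
  sumAssignments (m + n) (boolToℕ ∘ isCisPosition (K m n))
    ≡⟨ sumAssignments-++ m n _ ⟩
  sumAssignments m (λ xs → sumAssignments n (λ ys → boolToℕ (isCisPosition (K m n) (xs ++ ys))))
    ≡⟨ sumAssignments-cong m (sumAssignments-positions-K m n) ⟩
  sumAssignments m (λ xs → if anyColoured xs then 1 else 3 ^ n) ∎
  where open ≡-Reasoning

mainTheorem11 : (m n : ℕ) → m ≥ 1 → n ≥ 1 →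
    numCisPositions (K m n) ≡ (3 ^ m + 3 ^ n) ∸ 1
mainTheorem11 m n _ _ = begin
  numCisPositions (K m n)
    ≡⟨ sym (m+n∸n≡m _ 1) ⟩
  (numCisPositions (K m n) + 1) ∸ 1
    ≡⟨ cong (λ N → (N + 1) ∸ 1) (numCisPositions-K m n) ⟩
  (sumAssignments m (λ xs → if anyColoured xs then 1 else 3 ^ n) + 1) ∸ 1
    ≡⟨ cong (_∸ 1) (sumAssignments-if-anyColoured m 1 (3 ^ n)) ⟩
  (1 * 3 ^ m + 3 ^ n) ∸ 1
    ≡⟨ cong (λ t → (t + 3 ^ n) ∸ 1) (*-identityˡ (3 ^ m)) ⟩
  (3 ^ m + 3 ^ n) ∸ 1 ∎
  where open ≡-Reasoning
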